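{- Let $H_1,\dots,H_s$ be the components of a split decomposition of a graph $G$. Then $G$ is word-representable if and only if $H_i$ is word-representable for all $1\le i\le s$. Further, (when these graphs are word-representable) $\mathcal{R}(G)=\max_{1\le i\le s}\mathcal{R}(H_i)$.
   Context: All graphs are finite, simple and connected. A graph $G=(V,E)$ is word-representable if there is a word $w$ over $V$ such that distinct $a,b\in V$ are adjacent iff they alternate in $w$ (i.e., the subword of $w$ formed by all occurrences of $a$ and $b$ is $abab\cdots$ or $baba\cdots$). $\mathcal{R}(G)$ (the representation number) is the smallest $k$ such that $G$ is represented by a word in which each letter occurs exactly $k$ times. A split of a connected graph $G=(V,E)$ is a bipartition $\{V_1,V_2\}$ of $V$ with $|V_1|,|V_2|\ge 2$ such that every vertex of $N_G(V_1)$ is adjacent to every vertex of $N_G(V_2)$, where $N_G(A)=\bigcup_{a\in A}N_G(a)\setminus A$. Given a split, $G$ is decomposed into the two split components $G_1$ on $V_1\cup\{v_1\}$ and $G_2$ on $V_2\cup\{v_2\}$, where $v_1,v_2$ are new vertices, $G_1$ is $G[V_1]$ plus $v_1$ adjacent to every vertex of $N_G(V_2)$, and $G_2$ is $G[V_2]$ plus $v_2$ adjacent to every vertex of $N_G(V_1)$. A split decomposition of $G$ is obtained by recursively decomposing split components in this way; its components are the resulting graphs. -}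

module Defs where

open import Data.Bool using (Bool; true; false; not; T; _∨_)
open import Data.Bool.Properties using (T-irrelevant)
open import Data.Nat using (ℕ)
open import Data.List using (List; []; _∷_; _++_; filterᵇ; length)
open import Data.List.Membership.Propositional using (_∈_)
open import Data.Maybe using (Maybe; nothing; just)
import Data.Maybe.Properties as MaybeP
open import Data.Product using (Σ; _×_; _,_; proj₁)
open import Data.Empty using (⊥)
open import Relation.Nullary using (¬_; Dec; yes; no; does)
open import Relation.Binary.Definitions using (DecidableEquality)
open import Relation.Binary.PropositionalEquality using (_≡_; _≢_; refl; cong)

record Graph : Set₁ where
  field
    V      : Set
    _≟_    : DecidableEquality V
    E      : V → V → Set
    E-sym  : ∀ {u v} → E u v → E v u
    E-irr  : ∀ {v} → ¬ E v v

open Graph public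

Finite : Graph → Set
Finite G = Σ (List (V G)) λ vs → ∀ v → v ∈ vs

data Path (G : Graph) : V G → V G → Set where
  here : ∀ {v} → Path G v v
  step : ∀ {u w v} → E G u w → Path G w v → Path G u v

Connected : Graph → Set
Connected G = ∀ u v → Path G u v

Alternating : {A : Set} → List A → Set
Alternating []           = Data.Unit.⊤
  where import Data.Unit
Alternating (x ∷ [])     = Data.Unit.⊤
  where import Data.Unit
Alternating (x ∷ y ∷ r)  = x ≢ y × Alternating (y ∷ r)

module _ (G : Graph) where
  private
    _≟V_ = _≟_ G

  restrict : V G → V G → List (V G) → List (V G)
  restrict a b = filterᵇ (λ x → does (x ≟V a) ∨ does (x ≟V b))

  Alternate : V G → V G → List (V G) → Set
  Alternate a b w = Alternating (restrict a b w)

  occ : V G → List (V G) → ℕ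
  occ a w = length (filterᵇ (λ x → does (x ≟V a)) w)

  Represents : List (V G) → Set
  Represents w = (∀ v → v ∈ w)
               × (∀ a b → a ≢ b → (E G a b → Alternate a b w) × (Alternate a b w → E G a b))

  WordRepresentable : Set
  WordRepresentable = Σ (List (V G)) Represents

  KRepresentable : ℕ → Set
  KRepresentable k = Σ (List (V G)) λ w → Represents w × (∀ v → occ v w ≡ k)

  RepNumber : ℕ → Set
  RepNumber k = KRepresentable k × (∀ j → KRepresentable j → k Data.Nat.≤ j)
    where import Data.Nat

-- Splits and split decompositions.  A bipartition {V₁,V₂} of V is given
-- by S : V → Bool with V₁ = {x | S x = true}, V₂ = {x | S x = false}.

module _ (G : Graph) where

  AtLeastTwo : (V G → Bool) → Set
  AtLeastTwo P = Σ (V G) λ x → Σ (V G) λ y → x ≢ y × T (P x) × T (P y)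

  InNbhd : (V G → Bool) → V G → Set
  InNbhd P x = T (not (P x)) × Σ (V G) λ z → T (P z) × E G z x

  IsSplit : (V G → Bool) → Set
  IsSplit S = AtLeastTwo S × AtLeastTwo (λ x → not (S x))
            × (∀ x y → InNbhd S x → InNbhd (λ z → not (S z)) y → E G x y)

  -- the split component on A ∪ {a}, where A = {x | P x} and the new
  -- vertex a (= nothing) is adjacent to every vertex of N_G(V ∖ A)
  private
    CV : (V G → Bool) → Set
    CV P = Maybe (Σ (V G) λ x → T (P x))

    decΣ : (P : V G → Bool) → DecidableEquality (Σ (V G) λ x → T (P x))
    decΣ P (x , p) (y , q) with _≟_ G x y
    ... | yes refl = yes (cong (x ,_) (T-irrelevant p q))
    ... | no ne = no (λ eq → ne (cong proj₁ eq))

    CE : (P : V G → Bool) → CV P → CV P → Set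
    CE P nothing nothing = ⊥
    CE P nothing (just (y , _)) = InNbhd (λ z → not (P z)) y
    CE P (just (x , _)) nothing = InNbhd (λ z → not (P z)) x
    CE P (just (x , _)) (just (y , _)) = E G x y

    CE-sym : (P : V G → Bool) → ∀ {u v} → CE P u v → CE P v u
    CE-sym P {nothing} {just _} e = e
    CE-sym P {just _} {nothing} e = e
    CE-sym P {just _} {just _} e = E-sym G e

    CE-irr : (P : V G → Bool) → ∀ {v} → ¬ CE P v v
    CE-irr P {nothing} ()
    CE-irr P {just _} e = E-irr G e

  component : (V G → Bool) → Graph
  component P = record
    { V = CV P
    ; _≟_ = MaybeP.≡-dec (decΣ P)
    ; E = CE P
    ; E-sym = λ {u} {v} → CE-sym P {u} {v}
    ; E-irr = λ {v} → CE-irr P {v}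
    }

data SplitDecomposition : Graph → List Graph → Set₁ where
  trivial : ∀ {G} → SplitDecomposition G (G ∷ [])
  split   : ∀ {G L₁ L₂} (S : V G → Bool) → IsSplit G S
          → SplitDecomposition (component G S) L₁
          → SplitDecomposition (component G (λ x → not (S x))) L₂
          → SplitDecomposition G (L₁ ++ L₂)

{-# OPTIONS --safe #-}
-- Let {V₁, V₂} be a split of the connected graph G.  Connectivity yields an edge x₀y₀ with
-- x₀ ∈ V₁ and y₀ ∈ V₂, and by the split property the component on V₁ is the subgraph induced
-- on V₁ ∪ {y₀}, the one on V₂ the subgraph induced on V₂ ∪ {x₀}.  Restricting a word in which
-- every letter occurs k times therefore gives such words for both components.  Conversely,
-- rotate a k-uniform word for the V₂-side (a rotation of a uniform representant still
-- represents) until it reads x₀ s₁ x₀ s₂ ⋯ x₀ sₖ, and substitute sᵢ for the i-th occurrence of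
-- y₀ in a k-uniform word for the V₁-side.  Pairs inside V₁ or inside V₂ keep their subwords;
-- for a ∈ V₁ and b ∈ V₂ the subword alternates iff every sᵢ contains b exactly once and a, y₀
-- alternate, i.e. iff x₀b and ay₀ are edges, which for a split means that ab is an edge.
-- So G is k-representable iff both components are, for every k, and by induction iff all
-- components of a split decomposition are.  Both statements follow since a word-representable
-- graph is k-representable for some k, and prefixing the initial permutation turns a
-- k-representant into a (k+1)-representant.
module Submission where

open import Defs
open import Data.Bool using (Bool; true; false; not; T; _∨_; if_then_else_)
import Data.Bool.Properties as Boolₚ
open import Data.Nat using (ℕ; zero; suc; _+_; _∸_; _≤_; _<_; _<ᵇ_; _⊔_; z≤n; s≤s)
import Data.Nat.Properties as ℕₚ
open import Data.List
  using (List; []; _∷_; _++_; _∷ʳ_; [_]; filter; filterᵇ; length; map; concat; foldr; deduplicate)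
import Data.List.Properties as Listₚ
open import Data.List.Relation.Unary.All as All using (All; []; _∷_)
import Data.List.Relation.Unary.All.Properties as Allₚ
import Data.List.Membership.Propositional.Properties as Membershipₚ
open import Data.List.Relation.Unary.Any using (here; there)
open import Data.List.Membership.Propositional using (_∈_)
open import Data.List.Relation.Binary.Pointwise as Pointwiseₚ using (Pointwise; []; _∷_)
open import Data.Maybe using (just; nothing)
open import Data.Product using (Σ; ∃; _×_; _,_; proj₁; proj₂)
open import Data.Product.Function.NonDependent.Propositional using (_×-⇔_)
open import Data.Sum as Sum using (_⊎_; inj₁; inj₂)
open import Data.Unit using (tt)
open import Data.Empty using (⊥; ⊥-elim)
open import Function using (_∘_)
open import Function.Bundles using (_⇔_; mk⇔; Equivalence)
import Function.Properties.Equivalence as ⇔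
open import Relation.Nullary using (¬_; yes; no; does; ¬?)
open import Relation.Unary using (Pred; Decidable)
open import Level using (0ℓ)
open import Relation.Nullary.Decidable using (dec-true; dec-false)
open import Relation.Binary.Definitions using (DecidableEquality)
open import Relation.Binary.PropositionalEquality
  using (_≡_; _≢_; refl; sym; trans; cong; cong₂; subst; module ≡-Reasoning)

T-not-not : ∀ {b} → T b → T (not (not b))
T-not-not {true} _ = tt

module _ {A : Set} where

  filter-comm : ∀ {P Q : Pred A 0ℓ} (P? : Decidable P) (Q? : Decidable Q) xs
              → filter P? (filter Q? xs) ≡ filter Q? (filter P? xs)
  filter-comm P? Q? [] = refl
  filter-comm P? Q? (x ∷ xs) with does (P? x) in p | does (Q? x) in q
  ... | true  | true  rewrite p | q = cong (x ∷_) (filter-comm P? Q? xs)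
  ... | true  | false rewrite q = filter-comm P? Q? xs
  ... | false | true  rewrite p = filter-comm P? Q? xs
  ... | false | false = filter-comm P? Q? xs

  filterᵇ-cong : ∀ {p q : A → Bool} → (∀ x → p x ≡ q x) → ∀ xs → filterᵇ p xs ≡ filterᵇ q xs
  filterᵇ-cong p≗q = Listₚ.filter-≐ _ _ ((λ {x} → subst T (p≗q x)) , (λ {x} → subst T (sym (p≗q x))))

  filterᵇ-cong-local : ∀ {p q : A → Bool} {xs} → All (λ x → p x ≡ q x) xs → filterᵇ p xs ≡ filterᵇ q xs
  filterᵇ-cong-local {p} {q} {[]}     []       = refl
  filterᵇ-cong-local {p} {q} {x ∷ xs} (e ∷ es) rewrite e with q x
  ... | true  = cong (x ∷_) (filterᵇ-cong-local es)
  ... | false = filterᵇ-cong-local es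

  filterᵇ-none : ∀ {p : A → Bool} {xs} → All (λ x → p x ≡ false) xs → filterᵇ p xs ≡ []
  filterᵇ-none = Listₚ.filter-none _ ∘ All.map (subst T)

  filterᵇ-true : ∀ (p : A → Bool) xs → All (λ x → p x ≡ true) (filterᵇ p xs)
  filterᵇ-true p xs = All.map (Equivalence.to Boolₚ.T-≡) (Allₚ.all-filter _ xs)

  filterᵇ-map : ∀ {B : Set} (p : B → Bool) (f : A → B) xs
              → filterᵇ p (map f xs) ≡ map f (filterᵇ (p ∘ f) xs)
  filterᵇ-map p f [] = refl
  filterᵇ-map p f (x ∷ xs) with p (f x)
  ... | true  = cong (f x ∷_) (filterᵇ-map p f xs)
  ... | false = filterᵇ-map p f xs

  filterᵇ-concat : ∀ (p : A → Bool) xss → filterᵇ p (concat xss) ≡ concat (map (filterᵇ p) xss)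
  filterᵇ-concat p []         = refl
  filterᵇ-concat p (xs ∷ xss) =
    trans (Listₚ.filter-++ _ xs (concat xss)) (cong (filterᵇ p xs ++_) (filterᵇ-concat p xss))

  Over : A → A → List A → Set
  Over a b = All (λ z → z ≡ a ⊎ z ≡ b)

  Over-swap : ∀ {a b xs} → Over a b xs → Over b a xs
  Over-swap = All.map Sum.swap

  Alternating-≡ : ∀ {xs ys : List A} → xs ≡ ys → Alternating xs ⇔ Alternating ys
  Alternating-≡ refl = ⇔.refl

  alternating-tail : ∀ {x : A} xs → Alternating (x ∷ xs) → Alternating xs
  alternating-tail []      _       = tt
  alternating-tail (_ ∷ _) (_ , α) = α

  alternating-++⁻ˡ : ∀ (xs : List A) {ys} → Alternating (xs ++ ys) → Alternating xs
  alternating-++⁻ˡ []           _       = tt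
  alternating-++⁻ˡ (x ∷ [])     _       = tt
  alternating-++⁻ˡ (x ∷ y ∷ xs) (x≢y , α) = x≢y , alternating-++⁻ˡ (y ∷ xs) α

  alternating-++⁻ʳ : ∀ (xs : List A) {ys} → Alternating (xs ++ ys) → Alternating ys
  alternating-++⁻ʳ []       α = α
  alternating-++⁻ʳ (x ∷ xs) α = alternating-++⁻ʳ xs (alternating-tail (xs ++ _) α)

  alternating-∷ʳ : ∀ (xs : List A) {y z} → Alternating (xs ∷ʳ y) → y ≢ z → Alternating (xs ∷ʳ y ∷ʳ z)
  alternating-∷ʳ []           _         y≢z = y≢z , tt
  alternating-∷ʳ (x ∷ [])     (x≢y , _) y≢z = x≢y , y≢z , tt
  alternating-∷ʳ (x ∷ x′ ∷ xs) (x≢x′ , α) y≢z = x≢x′ , alternating-∷ʳ (x′ ∷ xs) α y≢z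

  alternating-map⁻ : ∀ {B : Set} (f : A → B) xs → Alternating (map f xs) → Alternating xs
  alternating-map⁻ f []           _         = tt
  alternating-map⁻ f (x ∷ [])     _         = tt
  alternating-map⁻ f (x ∷ y ∷ xs) (fx≢fy , α) = (fx≢fy ∘ cong f) , alternating-map⁻ f (y ∷ xs) α

  alternating-map⁺ : ∀ {B : Set} (f : A → B) {a b} → f a ≢ f b
                   → ∀ xs → Over a b xs → Alternating xs → Alternating (map f xs)
  alternating-map⁺ f fa≢fb []           _                     _         = tt
  alternating-map⁺ f fa≢fb (x ∷ [])     _                     _         = tt
  alternating-map⁺ f fa≢fb (x ∷ y ∷ xs) (x∈ ∷ y∈ ∷ xs∈) (x≢y , α) =
    distinct x∈ y∈ , alternating-map⁺ f fa≢fb (y ∷ xs) (y∈ ∷ xs∈) α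
    where
    distinct : x ≡ _ ⊎ x ≡ _ → y ≡ _ ⊎ y ≡ _ → f x ≢ f y
    distinct (inj₁ refl) (inj₁ refl) _ = x≢y refl
    distinct (inj₂ refl) (inj₂ refl) _ = x≢y refl
    distinct (inj₁ refl) (inj₂ refl) e = fa≢fb e
    distinct (inj₂ refl) (inj₁ refl) e = fa≢fb (sym e)

-- For _≟_ = _≟_ G, count and subword are definitionally occ G and restrict G.
module Words {A : Set} (_≟_ : DecidableEquality A) where

  infix 7 _≡ᵇ_
  _≡ᵇ_ : A → A → Bool
  x ≡ᵇ a = does (x ≟ a)

  ≡ᵇ-refl : ∀ a → (a ≡ᵇ a) ≡ true
  ≡ᵇ-refl a = dec-true (a ≟ a) refl

  ≢⇒≡ᵇ-false : ∀ {x a} → x ≢ a → (x ≡ᵇ a) ≡ false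
  ≢⇒≡ᵇ-false {x} {a} = dec-false (x ≟ a)

  ≡ᵇ-true⇒≡ : ∀ {x a} → (x ≡ᵇ a) ≡ true → x ≡ a
  ≡ᵇ-true⇒≡ {x} {a} e with x ≟ a
  ... | yes x≡a = x≡a

  count : A → List A → ℕ
  count a w = length (filterᵇ (_≡ᵇ a) w)

  subword : A → A → List A → List A
  subword a b = filterᵇ (λ x → x ≡ᵇ a ∨ x ≡ᵇ b)

  count-++ : ∀ a xs ys → count a (xs ++ ys) ≡ count a xs + count a ys
  count-++ a xs ys = trans (cong length (Listₚ.filter-++ _ xs ys)) (Listₚ.length-++ (filterᵇ (_≡ᵇ a) xs))

  count-++-comm : ∀ a xs ys → count a (xs ++ ys) ≡ count a (ys ++ xs)
  count-++-comm a xs ys = trans (count-++ a xs ys) (trans (ℕₚ.+-comm (count a xs) _) (sym (count-++ a ys xs)))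

  count-head : ∀ a t → count a (a ∷ t) ≡ suc (count a t)
  count-head a t rewrite ≡ᵇ-refl a = refl

  count-∷-≢ : ∀ {x a} t → x ≢ a → count a (x ∷ t) ≡ count a t
  count-∷-≢ t x≢a rewrite ≢⇒≡ᵇ-false x≢a = refl

  ∈⇒count>0 : ∀ {v w} → v ∈ w → 0 < count v w
  ∈⇒count>0 {v} {x ∷ w} (here refl) rewrite count-head v w = s≤s z≤n
  ∈⇒count>0 {v} {x ∷ w} (there v∈w) with x ≟ v
  ... | yes _ = s≤s z≤n
  ... | no _  = ∈⇒count>0 v∈w

  count>0⇒∈ : ∀ {v} w → 0 < count v w → v ∈ w
  count>0⇒∈ {v} (x ∷ w) c with x ≟ v
  ... | yes x≡v = here (sym x≡v)
  ... | no _    = there (count>0⇒∈ w c)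

  count-filterᵇ : ∀ (Y : A → Bool) {v} w → Y v ≡ true → count v (filterᵇ Y w) ≡ count v w
  count-filterᵇ Y {v} w Yv =
    cong length (trans (filter-comm _ _ w) (Listₚ.filter-all _ (All.map Y-holds (filterᵇ-true _ w))))
    where
    Y-holds : ∀ {z} → (z ≡ᵇ v) ≡ true → T (Y z)
    Y-holds z≡v rewrite ≡ᵇ-true⇒≡ z≡v = Equivalence.from Boolₚ.T-≡ Yv

  count-filterᵇ-false : ∀ (Y : A → Bool) {v} w → Y v ≡ false → count v (filterᵇ Y w) ≡ 0
  count-filterᵇ-false Y {v} w Yv =
    cong length (trans (filter-comm _ _ w) (filterᵇ-none (All.map Y-fails (filterᵇ-true _ w))))
    where
    Y-fails : ∀ {z} → (z ≡ᵇ v) ≡ true → Y z ≡ false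
    Y-fails z≡v rewrite ≡ᵇ-true⇒≡ z≡v = Yv

  subword-Over : ∀ a b w → Over a b (subword a b w)
  subword-Over a b w = All.map letter (filterᵇ-true _ w)
    where
    letter : ∀ {x} → (x ≡ᵇ a ∨ x ≡ᵇ b) ≡ true → x ≡ a ⊎ x ≡ b
    letter {x} e with x ≟ a | x ≟ b
    ... | yes x≡a | _       = inj₁ x≡a
    ... | no _    | yes x≡b = inj₂ x≡b

  subword-comm : ∀ a b w → subword a b w ≡ subword b a w
  subword-comm a b = filterᵇ-cong (λ x → Boolₚ.∨-comm (x ≡ᵇ a) (x ≡ᵇ b))

  count-subwordˡ : ∀ a b w → count a (subword a b w) ≡ count a w
  count-subwordˡ a b w = count-filterᵇ _ w (cong (_∨ a ≡ᵇ b) (≡ᵇ-refl a))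

  count-subwordʳ : ∀ a b w → count b (subword a b w) ≡ count b w
  count-subwordʳ a b w = count-filterᵇ _ w (trans (cong (b ≡ᵇ a ∨_) (≡ᵇ-refl b)) (Boolₚ.∨-zeroʳ _))

  ∈-subwordˡ : ∀ {a} b {w} → a ∈ w → a ∈ subword a b w
  ∈-subwordˡ {a} b {w} a∈w =
    count>0⇒∈ (subword a b w) (subst (0 <_) (sym (count-subwordˡ a b w)) (∈⇒count>0 a∈w))

  ∈-subwordʳ : ∀ a {b w} → b ∈ w → b ∈ subword a b w
  ∈-subwordʳ a {b} {w} b∈w =
    count>0⇒∈ (subword a b w) (subst (0 <_) (sym (count-subwordʳ a b w)) (∈⇒count>0 b∈w))

  subword-filterᵇ : ∀ (U : A → Bool) {a b} w → U a ≡ true → U b ≡ true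
                  → subword a b (filterᵇ U w) ≡ subword a b w
  subword-filterᵇ U {a} {b} w Ua Ub =
    trans (filter-comm _ _ w) (Listₚ.filter-all _ (All.map inU (subword-Over a b w)))
    where
    inU : ∀ {z} → z ≡ a ⊎ z ≡ b → T (U z)
    inU (inj₁ refl) = Equivalence.from Boolₚ.T-≡ Ua
    inU (inj₂ refl) = Equivalence.from Boolₚ.T-≡ Ub

  alternating-count-≤ : ∀ {a b} t → a ≢ b → Over a b t → Alternating (a ∷ t)
                      → count b t ≤ suc (count a t)
  alternating-count-≤ [] a≢b _ _ = z≤n
  alternating-count-≤ (_ ∷ _) a≢b (inj₁ refl ∷ _) (a≢a , _) = ⊥-elim (a≢a refl)
  alternating-count-≤ {a} {b} (_ ∷ []) a≢b (inj₂ refl ∷ []) _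
    rewrite count-head b [] | count-∷-≢ [] (a≢b ∘ sym) = s≤s z≤n
  alternating-count-≤ (_ ∷ _ ∷ _) a≢b (inj₂ refl ∷ inj₂ refl ∷ _) (_ , b≢b , _) =
    ⊥-elim (b≢b refl)
  alternating-count-≤ {a} {b} (_ ∷ _ ∷ t) a≢b (inj₂ refl ∷ inj₁ refl ∷ t∈) (_ , _ , α)
    rewrite count-head b (a ∷ t) | count-∷-≢ t a≢b | count-∷-≢ (a ∷ t) (a≢b ∘ sym) | count-head a t
    = s≤s (alternating-count-≤ t a≢b t∈ α)

  leading-count-≥ : ∀ {a b} w t → a ≢ b → Alternating (subword a b w) → subword a b w ≡ a ∷ t
                  → count b w ≤ count a w
  leading-count-≥ {a} {b} w t a≢b α eq = begin
    count b w                      ≡⟨ count-subwordʳ a b w ⟨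
    count b (subword a b w)        ≡⟨ cong (count b) eq ⟩
    count b (a ∷ t)                ≡⟨ count-∷-≢ t a≢b ⟩
    count b t                      ≤⟨ alternating-count-≤ t a≢b (All.tail (subst (Over a b) eq (subword-Over a b w)))
                                                                (subst Alternating eq α) ⟩
    suc (count a t)                ≡⟨ count-head a t ⟨
    count a (a ∷ t)                ≡⟨ cong (count a) eq ⟨
    count a (subword a b w)        ≡⟨ count-subwordˡ a b w ⟩
    count a w                      ∎
    where open ℕₚ.≤-Reasoning

  alternating-balanced-last : ∀ {a b} t → a ≢ b → Over a b t → Alternating (a ∷ t)
                            → suc (count a t) ≡ count b t → ∃ λ t′ → t ≡ t′ ∷ʳ b
  alternating-balanced-last [] a≢b _ _ ()
  alternating-balanced-last (_ ∷ _) a≢b (inj₁ refl ∷ _) (a≢a , _) _ = ⊥-elim (a≢a refl)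
  alternating-balanced-last (_ ∷ []) a≢b (inj₂ refl ∷ []) _ _ = [] , refl
  alternating-balanced-last (_ ∷ _ ∷ _) a≢b (inj₂ refl ∷ inj₂ refl ∷ _) (_ , b≢b , _) _ =
    ⊥-elim (b≢b refl)
  alternating-balanced-last {a} {b} (_ ∷ _ ∷ t) a≢b (inj₂ refl ∷ inj₁ refl ∷ t∈) (_ , _ , α) balanced
    rewrite count-head b (a ∷ t) | count-∷-≢ t a≢b | count-∷-≢ (a ∷ t) (a≢b ∘ sym) | count-head a t
    with alternating-balanced-last t a≢b t∈ α (ℕₚ.suc-injective balanced)
  ... | t′ , refl = b ∷ a ∷ t′ , refl

  private
    rotate-first : ∀ {a b} t → a ≢ b → Over a b t → count a (a ∷ t) ≡ count b (a ∷ t)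
                 → Alternating (a ∷ t) → Alternating (t ∷ʳ a)
    rotate-first {a} {b} t a≢b t∈ balanced α
      with alternating-balanced-last t a≢b t∈ α
             (trans (sym (count-head a t)) (trans balanced (count-∷-≢ t a≢b)))
    ... | t′ , refl = alternating-∷ʳ t′ (alternating-tail _ α) (a≢b ∘ sym)

  alternating-rotate₁ : ∀ {a b} c t → a ≢ b → Over a b (c ∷ t) → count a (c ∷ t) ≡ count b (c ∷ t)
                      → Alternating (c ∷ t) → Alternating (t ∷ʳ c)
  alternating-rotate₁ c t a≢b (inj₁ refl ∷ t∈) balanced = rotate-first t a≢b t∈ balanced
  alternating-rotate₁ c t a≢b (inj₂ refl ∷ t∈) balanced =
    rotate-first t (a≢b ∘ sym) (Over-swap t∈) (sym balanced)

  alternating-rotate : ∀ {a b} p q → a ≢ b → Over a b (p ++ q) → count a (p ++ q) ≡ count b (p ++ q)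
                     → Alternating (p ++ q) → Alternating (q ++ p)
  alternating-rotate [] q a≢b _ _ α = subst Alternating (sym (Listₚ.++-identityʳ q)) α
  alternating-rotate {a} {b} (c ∷ p) q a≢b (c∈ ∷ pq∈) balanced α =
    subst Alternating (Listₚ.++-assoc q [ c ] p)
      (alternating-rotate p (q ∷ʳ c) a≢b
        (subst (Over a b) (Listₚ.++-assoc p q [ c ]) (Allₚ.∷ʳ⁺ pq∈ c∈))
        (trans (moved a) (trans balanced (sym (moved b))))
        (subst Alternating (Listₚ.++-assoc p q [ c ])
          (alternating-rotate₁ c (p ++ q) a≢b (c∈ ∷ pq∈) balanced α)))
    where
    moved : ∀ x → count x (p ++ q ∷ʳ c) ≡ count x (c ∷ p ++ q)
    moved x = trans (cong (count x) (sym (Listₚ.++-assoc p q [ c ]))) (count-++-comm x (p ++ q) [ c ])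

  alternating-subword-rotate : ∀ {a b} p q → a ≢ b → count a (p ++ q) ≡ count b (p ++ q)
                             → Alternating (subword a b (p ++ q)) → Alternating (subword a b (q ++ p))
  alternating-subword-rotate {a} {b} p q a≢b balanced α =
    subst Alternating (sym (Listₚ.filter-++ _ q p))
      (alternating-rotate (subword a b p) (subword a b q) a≢b
        (subst (Over a b) subword-++ (subword-Over a b (p ++ q)))
        (subst (λ u → count a u ≡ count b u) subword-++
          (trans (count-subwordˡ a b (p ++ q)) (trans balanced (sym (count-subwordʳ a b (p ++ q))))))
        (subst Alternating subword-++ α))
    where
    subword-++ : subword a b (p ++ q) ≡ subword a b p ++ subword a b q
    subword-++ = Listₚ.filter-++ _ p q

  dedup : List A → List A
  dedup = deduplicate _≟_

  dedup-filterᵇ : ∀ (p : A → Bool) xs → dedup (filterᵇ p xs) ≡ filterᵇ p (dedup xs)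
  dedup-filterᵇ p [] = refl
  dedup-filterᵇ p (x ∷ xs) with p x in px
  ... | true =
    cong (x ∷_) (trans (cong (filter (¬? ∘ (x ≟_))) (dedup-filterᵇ p xs)) (filter-comm _ _ (dedup xs)))
  ... | false = begin
    dedup (filterᵇ p xs)                               ≡⟨ dedup-filterᵇ p xs ⟩
    filterᵇ p (dedup xs)
      ≡⟨ Listₚ.filter-all _ (All.map x≢ (filterᵇ-true p (dedup xs))) ⟨
    filter (¬? ∘ (x ≟_)) (filterᵇ p (dedup xs))        ≡⟨ filter-comm _ _ (dedup xs) ⟩
    filterᵇ p (filter (¬? ∘ (x ≟_)) (dedup xs))        ∎
    where
    open ≡-Reasoning
    x≢ : ∀ {z} → p z ≡ true → x ≢ z
    x≢ pz refl = Boolₚ.not-¬ px pz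

  count-dedup : ∀ {v w} → v ∈ w → count v (dedup w) ≡ 1
  count-dedup {v} {w} v∈w =
    trans (cong length (sym (dedup-filterᵇ (_≡ᵇ v) w)))
          (constant (filterᵇ (_≡ᵇ v) w) (∈⇒count>0 v∈w) (All.map ≡ᵇ-true⇒≡ (filterᵇ-true _ w)))
    where
    constant : ∀ xs → 0 < length xs → All (_≡ v) xs → length (dedup xs) ≡ 1
    constant (x ∷ xs) _ (refl ∷ xs≡x) =
      cong (suc ∘ length)
        (Listₚ.filter-none _ (All.map (λ { refl x≢x → x≢x refl }) (Allₚ.deduplicate⁺ _≟_ xs≡x)))

  dedup-two : ∀ {c d} t → c ≢ d → Over c d t → dedup (c ∷ d ∷ t) ≡ c ∷ d ∷ []
  dedup-two {c} {d} t c≢d t∈ = cong (c ∷_) (begin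
    filter (¬? ∘ (c ≟_)) (d ∷ filter (¬? ∘ (d ≟_)) (dedup t))
      ≡⟨ Listₚ.filter-accept (¬? ∘ (c ≟_)) c≢d ⟩
    d ∷ filter (¬? ∘ (c ≟_)) (filter (¬? ∘ (d ≟_)) (dedup t))
      ≡⟨ cong (d ∷_) (Listₚ.filter-none _ onlyC) ⟩
    d ∷ []
      ∎)
    where
    open ≡-Reasoning
    isC : ∀ {z} → ¬ d ≡ z × (z ≡ c ⊎ z ≡ d) → ¬ ¬ c ≡ z
    isC (_ , inj₁ refl) c≢c = c≢c refl
    isC (d≢d , inj₂ refl) _ = d≢d refl
    onlyC : All (λ z → ¬ ¬ c ≡ z) (filter (¬? ∘ (d ≟_)) (dedup t))
    onlyC = All.zipWith isC (Allₚ.all-filter _ (dedup t) , Allₚ.filter⁺ _ (Allₚ.deduplicate⁺ _≟_ t∈))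

  -- dedup w is the initial permutation of w.
  pad : (A → Bool) → List A → List A
  pad Y w = filterᵇ Y (dedup w) ++ w

  subword-pad : ∀ Y a b w → subword a b (pad Y w) ≡ pad Y (subword a b w)
  subword-pad Y a b w = begin
    subword a b (filterᵇ Y (dedup w) ++ w)              ≡⟨ Listₚ.filter-++ _ (filterᵇ Y (dedup w)) w ⟩
    subword a b (filterᵇ Y (dedup w)) ++ subword a b w
      ≡⟨ cong (_++ subword a b w) (filter-comm _ _ (dedup w)) ⟩
    filterᵇ Y (subword a b (dedup w)) ++ subword a b w
      ≡⟨ cong (λ u → filterᵇ Y u ++ subword a b w) (dedup-filterᵇ _ w) ⟨
    filterᵇ Y (dedup (subword a b w)) ++ subword a b w  ∎
    where open ≡-Reasoning

  count-pad : ∀ Y {v} w → v ∈ w → count v (pad Y w) ≡ (if Y v then suc (count v w) else count v w)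
  count-pad Y {v} w v∈w with Y v in Yv
  ... | true  = trans (count-++ v (filterᵇ Y (dedup w)) w)
                      (cong (_+ count v w) (trans (count-filterᵇ Y (dedup w) Yv) (count-dedup v∈w)))
  ... | false = trans (count-++ v (filterᵇ Y (dedup w)) w)
                      (cong (_+ count v w) (count-filterᵇ-false Y (dedup w) Yv))

  alternating-pad⁻ : ∀ Y w → Alternating (pad Y w) → Alternating w
  alternating-pad⁻ Y w = alternating-++⁻ʳ (filterᵇ Y (dedup w))

  alternating-second : ∀ {a b} t → a ≢ b → Over a b t → b ∈ t → Alternating (a ∷ t)
                     → Σ (List A) λ t₁ → t ≡ b ∷ t₁ × Over a b t₁
  alternating-second (_ ∷ _)  _ (inj₁ refl ∷ _)   _ (a≢a , _) = ⊥-elim (a≢a refl)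
  alternating-second (_ ∷ t₁) _ (inj₂ refl ∷ t₁∈) _ _         = t₁ , refl , t₁∈

  private
    alternating-pad-start : ∀ (Y : A → Bool) {c d} t → c ≢ d → Over c d t → Alternating (c ∷ d ∷ t)
                          → (Y c ≡ true → Y d ≡ false → ⊥) → Alternating (pad Y (c ∷ d ∷ t))
    alternating-pad-start Y {c} {d} t c≢d t∈ α ok =
      subst (λ u → Alternating (filterᵇ Y u ++ c ∷ d ∷ t)) (sym (dedup-two t c≢d t∈)) prefixed
      where
      prefixed : Alternating (filterᵇ Y (c ∷ d ∷ []) ++ c ∷ d ∷ t)
      prefixed with Y c
      ... | true with Y d
      ...   | true  = c≢d , (c≢d ∘ sym) , α
      ...   | false = ⊥-elim (ok refl refl)
      prefixed | false with Y d
      ...   | true  = (c≢d ∘ sym) , α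
      ...   | false = α

    ∈-tail : ∀ {x y : A} {t} → y ∈ x ∷ t → x ≢ y → y ∈ t
    ∈-tail (here y≡x)  x≢y = ⊥-elim (x≢y (sym y≡x))
    ∈-tail (there y∈t) _   = y∈t

  -- For r = c d ⋯ the prefix is the Y-part of [c, d]; it breaks alternation iff c ∈ Y and d ∉ Y.
  alternating-pad⁺ : ∀ (Y : A → Bool) {a b} r → a ≢ b → Over a b r → a ∈ r → b ∈ r → Alternating r
                   → (∀ t → Y a ≡ true → Y b ≡ false → r ≢ a ∷ t)
                   → (∀ t → Y b ≡ true → Y a ≡ false → r ≢ b ∷ t)
                   → Alternating (pad Y r)
  alternating-pad⁺ Y (_ ∷ t) a≢b (inj₁ refl ∷ t∈) _ b∈r α okᵃ _
    with alternating-second t a≢b t∈ (∈-tail b∈r a≢b) α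
  ... | t₁ , refl , t₁∈ = alternating-pad-start Y t₁ a≢b t₁∈ α (λ Ya Yb → okᵃ _ Ya Yb refl)
  alternating-pad⁺ Y (_ ∷ t) a≢b (inj₂ refl ∷ t∈) a∈r _ α _ okᵇ
    with alternating-second t (a≢b ∘ sym) (Over-swap t∈) (∈-tail a∈r (a≢b ∘ sym)) α
  ... | t₁ , refl , t₁∈ =
    alternating-pad-start Y t₁ (a≢b ∘ sym) t₁∈ α (λ Yb Ya → okᵇ _ Yb Ya refl)

  module Glue (x₀ y₀ : A) where

    separated : List (List A) → List A
    separated ss = concat (map (x₀ ∷_) ss)

    -- Surplus occurrences of y₀ are dropped; this never happens when count y₀ w ≡ length ss.
    glue : List A → List (List A) → List A
    glue []      ss = []
    glue (z ∷ w) ss with z ≟ y₀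
    glue (z ∷ w) []       | yes _ = glue w []
    glue (z ∷ w) (s ∷ ss) | yes _ = s ++ glue w ss
    glue (z ∷ w) ss       | no _  = z ∷ glue w ss

    filterᵇ-glue-left : ∀ (p : A → Bool) w ss → p y₀ ≡ false → All (All (λ z → p z ≡ false)) ss
                      → filterᵇ p (glue w ss) ≡ filterᵇ p w
    filterᵇ-glue-left p []      ss _ _ = refl
    filterᵇ-glue-left p (z ∷ w) ss py₀ ss-p with z ≟ y₀
    filterᵇ-glue-left p (z ∷ w) [] py₀ [] | yes refl rewrite py₀ = filterᵇ-glue-left p w [] py₀ []
    filterᵇ-glue-left p (z ∷ w) (s ∷ ss) py₀ (s-p ∷ ss-p) | yes refl rewrite py₀ = begin
      filterᵇ p (s ++ glue w ss)              ≡⟨ Listₚ.filter-++ _ s (glue w ss) ⟩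
      filterᵇ p s ++ filterᵇ p (glue w ss)
        ≡⟨ cong₂ _++_ (filterᵇ-none s-p) (filterᵇ-glue-left p w ss py₀ ss-p) ⟩
      filterᵇ p w                             ∎
      where open ≡-Reasoning
    ... | no _ with p z
    ...   | true  = cong (z ∷_) (filterᵇ-glue-left p w ss py₀ ss-p)
    ...   | false = filterᵇ-glue-left p w ss py₀ ss-p

    filterᵇ-glue-right : ∀ (p : A → Bool) w ss → All (λ z → z ≡ y₀ ⊎ p z ≡ false) w
                       → count y₀ w ≡ length ss
                       → filterᵇ p (glue w ss) ≡ filterᵇ p (concat ss)
    filterᵇ-glue-right p [] [] _ _ = refl
    filterᵇ-glue-right p (z ∷ w) ss (z-p ∷ w-p) c with z ≟ y₀
    filterᵇ-glue-right p (z ∷ w) [] _ () | yes refl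
    filterᵇ-glue-right p (z ∷ w) (s ∷ ss) (_ ∷ w-p) c | yes refl = begin
      filterᵇ p (s ++ glue w ss)              ≡⟨ Listₚ.filter-++ _ s (glue w ss) ⟩
      filterᵇ p s ++ filterᵇ p (glue w ss)
        ≡⟨ cong (filterᵇ p s ++_) (filterᵇ-glue-right p w ss w-p (ℕₚ.suc-injective c)) ⟩
      filterᵇ p s ++ filterᵇ p (concat ss)    ≡⟨ Listₚ.filter-++ _ s (concat ss) ⟨
      filterᵇ p (s ++ concat ss)              ∎
      where open ≡-Reasoning
    filterᵇ-glue-right p (z ∷ w) ss (inj₁ z≡y₀ ∷ _) c   | no z≢y₀ = ⊥-elim (z≢y₀ z≡y₀)
    filterᵇ-glue-right p (z ∷ w) ss (inj₂ pz ∷ w-p) c  | no _ rewrite pz = filterᵇ-glue-right p w ss w-p c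

    filterᵇ-glue : ∀ (p : A → Bool) w ss
                 → filterᵇ p (glue w ss) ≡ glue (filterᵇ (λ z → p z ∨ z ≡ᵇ y₀) w) (map (filterᵇ p) ss)
    filterᵇ-glue p [] ss = refl
    filterᵇ-glue p (z ∷ w) ss with z ≟ y₀
    filterᵇ-glue p (z ∷ w) [] | yes refl rewrite Boolₚ.∨-zeroʳ (p z) with z ≟ z
    ... | yes _ = filterᵇ-glue p w []
    ... | no z≢z = ⊥-elim (z≢z refl)
    filterᵇ-glue p (z ∷ w) (s ∷ ss) | yes refl rewrite Boolₚ.∨-zeroʳ (p z) with z ≟ z
    ... | yes _ = trans (Listₚ.filter-++ _ s (glue w ss)) (cong (filterᵇ p s ++_) (filterᵇ-glue p w ss))
    ... | no z≢z = ⊥-elim (z≢z refl)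
    filterᵇ-glue p (z ∷ w) ss | no z≢y₀ rewrite Boolₚ.∨-identityʳ (p z) with p z
    ... | false = filterᵇ-glue p w ss
    ... | true with z ≟ y₀
    ...   | yes z≡y₀ = ⊥-elim (z≢y₀ z≡y₀)
    ...   | no _     = cong (z ∷_) (filterᵇ-glue p w ss)

    glue-singletons : ∀ y r ts → All (_≡ [ y ]) ts → count y₀ r ≡ length ts
                    → glue r ts ≡ map (λ z → if z ≡ᵇ y₀ then y else z) r
    glue-singletons y [] [] _ _ = refl
    glue-singletons y [] (_ ∷ _) _ ()
    glue-singletons y (z ∷ r) ts ts≡ c with z ≟ y₀
    glue-singletons y (z ∷ r) [] _ () | yes refl
    glue-singletons y (z ∷ r) (_ ∷ ts) (refl ∷ ts≡) c | yes refl =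
      cong (y ∷_) (glue-singletons y r ts ts≡ (ℕₚ.suc-injective c))
    ... | no _ = cong (z ∷_) (glue-singletons y r ts ts≡ c)

    alternating-glue⁻ : ∀ r ts → count y₀ r ≡ length ts → Alternating (glue r ts) → All Alternating ts
    alternating-glue⁻ [] [] _ _ = []
    alternating-glue⁻ [] (_ ∷ _) () _
    alternating-glue⁻ (z ∷ r) ts c α with z ≟ y₀
    alternating-glue⁻ (z ∷ r) [] () α | yes refl
    alternating-glue⁻ (z ∷ r) (t ∷ ts) c α | yes refl =
      alternating-++⁻ˡ t α ∷ alternating-glue⁻ r ts (ℕₚ.suc-injective c) (alternating-++⁻ʳ t α)
    ... | no _ = alternating-glue⁻ r ts c (alternating-tail (glue r ts) α)

    alternating-separated : ∀ y ts → x₀ ≢ y → All (_≡ [ y ]) ts → Alternating (separated ts)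
    alternating-separated y []       _    _            = tt
    alternating-separated y (_ ∷ ts) x₀≢y (refl ∷ ts≡) = go ts ts≡
      where
      go : ∀ ts → All (_≡ [ y ]) ts → Alternating (x₀ ∷ y ∷ separated ts)
      go []       _            = x₀≢y , tt
      go (_ ∷ ts) (refl ∷ ts≡) = x₀≢y , (x₀≢y ∘ sym) , go ts ts≡

    alternating-separated⁻ : ∀ ts → Alternating (separated ts) → All Alternating ts
    alternating-separated⁻ []       _ = []
    alternating-separated⁻ (t ∷ ts) α =
      alternating-++⁻ˡ t α′ ∷ alternating-separated⁻ ts (alternating-++⁻ʳ t α′)
      where α′ = alternating-tail (t ++ separated ts) α

    All-separated⁻ : ∀ {Q : A → Set} ss → All Q (separated ss) → All (All Q) ss
    All-separated⁻ []       _          = []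
    All-separated⁻ (s ∷ ss) (_ ∷ s-ss) = Allₚ.++⁻ˡ s s-ss ∷ All-separated⁻ ss (Allₚ.++⁻ʳ s s-ss)

    filterᵇ-separated : ∀ (p : A → Bool) ss → p x₀ ≡ true
                      → filterᵇ p (separated ss) ≡ separated (map (filterᵇ p) ss)
    filterᵇ-separated p []       _   = refl
    filterᵇ-separated p (s ∷ ss) px₀ rewrite px₀ =
      cong (x₀ ∷_) (trans (Listₚ.filter-++ _ s (separated ss))
                          (cong (filterᵇ p s ++_) (filterᵇ-separated p ss px₀)))

    filterᵇ-separated-false : ∀ (p : A → Bool) ss → p x₀ ≡ false
                            → filterᵇ p (separated ss) ≡ filterᵇ p (concat ss)
    filterᵇ-separated-false p []       _   = refl
    filterᵇ-separated-false p (s ∷ ss) px₀ rewrite px₀ = begin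
      filterᵇ p (s ++ separated ss)              ≡⟨ Listₚ.filter-++ _ s (separated ss) ⟩
      filterᵇ p s ++ filterᵇ p (separated ss)
        ≡⟨ cong (filterᵇ p s ++_) (filterᵇ-separated-false p ss px₀) ⟩
      filterᵇ p s ++ filterᵇ p (concat ss)       ≡⟨ Listₚ.filter-++ _ s (concat ss) ⟨
      filterᵇ p (s ++ concat ss)                 ∎
      where open ≡-Reasoning

    count-separated : ∀ ss → All (All (_≢ x₀)) ss → count x₀ (separated ss) ≡ length ss
    count-separated []       _            = refl
    count-separated (s ∷ ss) (s≢ ∷ ss≢) rewrite ≡ᵇ-refl x₀ = cong suc (begin
      count x₀ (s ++ separated ss)              ≡⟨ count-++ x₀ s (separated ss) ⟩
      count x₀ s + count x₀ (separated ss)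
        ≡⟨ cong₂ _+_ (cong length (filterᵇ-none (All.map ≢⇒≡ᵇ-false s≢))) (count-separated ss ss≢) ⟩
      length ss                                 ∎)
      where open ≡-Reasoning

    separate : ∀ w → Σ (List A) λ pre → Σ (List (List A)) λ ss →
               w ≡ pre ++ separated ss × All (All (_≢ x₀)) (pre ∷ ss)
    separate [] = [] , [] , refl , [] ∷ []
    separate (z ∷ w) with separate w
    ... | pre , ss , refl , pre≢ ∷ ss≢ with z ≟ x₀
    ...   | yes refl = [] , pre ∷ ss , refl , [] ∷ pre≢ ∷ ss≢
    ...   | no z≢x₀  = z ∷ pre , ss , refl , (z≢x₀ ∷ pre≢) ∷ ss≢

    rotation-separated : ∀ {w} → x₀ ∈ w → Σ (List A) λ p → Σ (List A) λ q → Σ (List (List A)) λ ss →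
                         w ≡ p ++ q × q ++ p ≡ separated ss × All (All (_≢ x₀)) ss
    rotation-separated x₀∈w with Membershipₚ.∈-∃++ x₀∈w
    ... | p , q , refl with separate (q ++ p)
    ...   | pre , ss , eq , pre≢ ∷ ss≢ =
      p , x₀ ∷ q , pre ∷ ss , refl , cong (x₀ ∷_) eq , pre≢ ∷ ss≢

    private
      length-≤1 : ∀ {y : A} t → All (_≡ y) t → Alternating t → length t ≤ 1
      length-≤1 []          _                _         = z≤n
      length-≤1 (_ ∷ [])    _                _         = s≤s z≤n
      length-≤1 (_ ∷ _ ∷ _) (refl ∷ refl ∷ _) (y≢y , _) = ⊥-elim (y≢y refl)

      length-concat-≤ : ∀ {y : A} ts → All (All (_≡ y)) ts → All Alternating ts
                      → length (concat ts) ≤ length ts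
      length-concat-≤ []       _          _        = z≤n
      length-concat-≤ (t ∷ ts) (t≡ ∷ ts≡) (α ∷ αs) =
        ℕₚ.≤-trans (ℕₚ.≤-reflexive (Listₚ.length-++ t))
                   (ℕₚ.+-mono-≤ (length-≤1 t t≡ α) (length-concat-≤ ts ts≡ αs))

    segments-singleton : ∀ {y : A} ts → All (All (_≡ y)) ts → All Alternating ts
                       → length (concat ts) ≡ length ts
                       → All (_≡ [ y ]) ts
    segments-singleton [] _ _ _ = []
    segments-singleton ([] ∷ ts) (_ ∷ ts≡) (_ ∷ αs) total =
      ⊥-elim (ℕₚ.1+n≰n (subst (_≤ length ts) total (length-concat-≤ ts ts≡ αs)))
    segments-singleton ((_ ∷ []) ∷ ts) ((refl ∷ []) ∷ ts≡) (_ ∷ αs) total =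
      refl ∷ segments-singleton ts ts≡ αs (ℕₚ.suc-injective total)
    segments-singleton ((_ ∷ _ ∷ _) ∷ ts) ((refl ∷ refl ∷ _) ∷ _) ((y≢y , _) ∷ _) _ =
      ⊥-elim (y≢y refl)

    -- There are as many segments as copies of b: either each is [ b ], and the glued word is r
    -- with y₀ renamed to b, or one of them contains b b.
    alternating-glue⇔ : ∀ {a b} r ts → a ≢ y₀ → a ≢ b → x₀ ≢ b → Over a y₀ r → All (All (_≡ b)) ts
                      → count y₀ r ≡ length ts → length (concat ts) ≡ length ts
                      → Alternating (glue r ts) ⇔ (Alternating (separated ts) × Alternating r)
    alternating-glue⇔ {a} {b} r ts a≢y₀ a≢b x₀≢b r∈ ts≡b count-r length-ts = mk⇔ to from
      where
      rename : A → A
      rename z = if z ≡ᵇ y₀ then b else z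
      rename-distinct : rename a ≢ rename y₀
      rename-distinct rewrite ≢⇒≡ᵇ-false a≢y₀ | ≡ᵇ-refl y₀ = a≢b
      singletons : All Alternating ts → All (_≡ [ b ]) ts
      singletons αs = segments-singleton ts ts≡b αs length-ts
      glue≡rename : All Alternating ts → glue r ts ≡ map rename r
      glue≡rename αs = glue-singletons b r ts (singletons αs) count-r
      to : Alternating (glue r ts) → Alternating (separated ts) × Alternating r
      to α = alternating-separated b ts x₀≢b (singletons αs) ,
             alternating-map⁻ rename r (subst Alternating (glue≡rename αs) α)
        where αs = alternating-glue⁻ r ts count-r α
      from : Alternating (separated ts) × Alternating r → Alternating (glue r ts)
      from (α-ts , α-r) =
        subst Alternating (sym (glue≡rename αs)) (alternating-map⁺ rename rename-distinct r r∈ α-r)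
        where αs = alternating-separated⁻ ts α-ts

module WordMap {A B : Set} (_≟ᴬ_ : DecidableEquality A) (_≟ᴮ_ : DecidableEquality B)
               (f : A → B) (f-injective : ∀ {x y} → f x ≡ f y → x ≡ y) where
  private
    module WA = Words _≟ᴬ_
    module WB = Words _≟ᴮ_

    ≡ᵇ-map : ∀ x a → (f x WB.≡ᵇ f a) ≡ (x WA.≡ᵇ a)
    ≡ᵇ-map x a with x ≟ᴬ a | f x ≟ᴮ f a
    ... | yes _    | yes _     = refl
    ... | no _     | no _      = refl
    ... | yes refl | no fx≢fx  = ⊥-elim (fx≢fx refl)
    ... | no x≢a   | yes fx≡fa = ⊥-elim (x≢a (f-injective fx≡fa))

  subword-map : ∀ a b w → WB.subword (f a) (f b) (map f w) ≡ map f (WA.subword a b w)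
  subword-map a b w =
    trans (filterᵇ-map _ f w) (cong (map f) (filterᵇ-cong (λ z → cong₂ _∨_ (≡ᵇ-map z a) (≡ᵇ-map z b)) w))

  count-map : ∀ a w → WB.count (f a) (map f w) ≡ WA.count a w
  count-map a w =
    trans (cong length (trans (filterᵇ-map _ f w) (cong (map f) (filterᵇ-cong (λ z → ≡ᵇ-map z a) w))))
          (Listₚ.length-map f (filterᵇ (WA._≡ᵇ a) w))

  alternating-subword-map : ∀ {a b} w → a ≢ b
                          → Alternating (WA.subword a b w) ⇔ Alternating (WB.subword (f a) (f b) (map f w))
  alternating-subword-map {a} {b} w a≢b = mk⇔
    (λ α → subst Alternating (sym (subword-map a b w))
             (alternating-map⁺ f (a≢b ∘ f-injective) _ (WA.subword-Over a b w) α))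
    (λ α → alternating-map⁻ f _ (subst Alternating (subword-map a b w) α))

-- Uniform representants

module Uniform (G : Graph) where
  open Words (_≟_ G)

  Paddable : (V G → Bool) → List (V G) → Set
  Paddable Y w = ∀ {a b} t → Y a ≡ true → Y b ≡ false → Alternate G a b w → subword a b w ≢ a ∷ t

  pad-represents : ∀ Y w → Represents G w → Paddable Y w → Represents G (pad Y w)
  pad-represents Y w (w-all , w-rep) paddable =
    (λ v → Membershipₚ.∈-++⁺ʳ _ (w-all v)) ,
    λ a b a≢b → to a≢b ∘ proj₁ (w-rep a b a≢b) , proj₂ (w-rep a b a≢b) ∘ from
    where
    from : ∀ {a b} → Alternate G a b (pad Y w) → Alternate G a b w
    from {a} {b} α = alternating-pad⁻ Y (subword a b w) (subst Alternating (subword-pad Y a b w) α)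
    to : ∀ {a b} → a ≢ b → Alternate G a b w → Alternate G a b (pad Y w)
    to {a} {b} a≢b α = subst Alternating (sym (subword-pad Y a b w))
      (alternating-pad⁺ Y (subword a b w) a≢b (subword-Over a b w)
                        (∈-subwordˡ b (w-all a)) (∈-subwordʳ a (w-all b)) α
        (λ t Ya Yb → paddable t Ya Yb α)
        (λ t Yb Ya eq → paddable t Yb Ya (subst Alternating (subword-comm a b w) α)
                                         (trans (sym (subword-comm a b w)) eq)))

  KRepresentable-suc : ∀ {k} → KRepresentable G k → KRepresentable G (suc k)
  KRepresentable-suc (w , rep , counts) =
    pad all w , pad-represents all w rep (λ _ _ ()) ,
    λ v → trans (count-pad all w (proj₁ rep v)) (cong suc (counts v))
    where
    all : V G → Bool
    all _ = true

  KRepresentable-+ : ∀ {k} d → KRepresentable G k → KRepresentable G (d + k)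
  KRepresentable-+ zero    r = r
  KRepresentable-+ (suc d) r = KRepresentable-suc (KRepresentable-+ d r)

  KRepresentable-mono : ∀ {k m} → k ≤ m → KRepresentable G k → KRepresentable G m
  KRepresentable-mono {k} {m} k≤m r =
    subst (KRepresentable G) (ℕₚ.m∸n+n≡m k≤m) (KRepresentable-+ (m ∸ k) r)

  private
    below : ℕ → List (V G) → V G → Bool
    below M w v = count v w <ᵇ M

    below-paddable : ∀ M w → Paddable (below M w) w
    below-paddable M w {a} {b} t a-below b-above α eq = ℕₚ.<⇒≱ a<b (leading-count-≥ w t a≢b α eq)
      where
      a<M : count a w < M
      a<M = ℕₚ.<ᵇ⇒< _ _ (Equivalence.from Boolₚ.T-≡ a-below)
      M≤b : M ≤ count b w
      M≤b = ℕₚ.≮⇒≥ (λ b<M → subst T b-above (ℕₚ.<⇒<ᵇ b<M))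
      a<b : count a w < count b w
      a<b = ℕₚ.<-≤-trans a<M M≤b
      a≢b : a ≢ b
      a≢b refl = ℕₚ.<-irrefl refl a<b

  -- Counts stay within [M ∸ j, M]: a round adds one copy of exactly the letters occurring < M times.
  uniformize : ∀ M j w → Represents G w → (∀ v → count v w ≤ M) → (∀ v → M ≤ j + count v w)
             → KRepresentable G M
  uniformize M zero    w rep ≤M M≤ = w , rep , λ v → ℕₚ.≤-antisym (≤M v) (M≤ v)
  uniformize M (suc j) w rep ≤M M≤ =
    uniformize M j (pad Y w) (pad-represents Y w rep (below-paddable M w)) ≤M′ M≤′
    where
    Y = below M w
    ≤M′ : ∀ v → count v (pad Y w) ≤ M
    ≤M′ v with Y v in Yv | count-pad Y w (proj₁ rep v)
    ... | true  | eq = subst (_≤ M) (sym eq) (ℕₚ.<ᵇ⇒< _ _ (Equivalence.from Boolₚ.T-≡ Yv))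
    ... | false | eq = subst (_≤ M) (sym eq) (≤M v)
    M≤′ : ∀ v → M ≤ j + count v (pad Y w)
    M≤′ v with Y v in Yv | count-pad Y w (proj₁ rep v)
    ... | true  | eq = subst (λ c → M ≤ j + c) (sym eq)
                        (subst (M ≤_) (sym (ℕₚ.+-suc j (count v w))) (M≤ v))
    ... | false | eq = subst (λ c → M ≤ j + c) (sym eq)
                        (ℕₚ.≤-trans (ℕₚ.≮⇒≥ (λ v<M → subst T Yv (ℕₚ.<⇒<ᵇ v<M)))
                                    (ℕₚ.m≤n+m (count v w) j))

  WordRepresentable⇒KRepresentable : WordRepresentable G → Σ ℕ (KRepresentable G)
  WordRepresentable⇒KRepresentable (w , rep) =
    length w ,
    uniformize (length w) (length w) w rep (λ v → Listₚ.length-filter _ w) (λ v → ℕₚ.m≤m+n (length w) _)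

-- Induced subgraphs and split components

record KRepresentsOn (G : Graph) (U : V G → Bool) (k : ℕ) (w : List (V G)) : Set where
  field
    over      : All (λ z → U z ≡ true) w
    alternate : ∀ {a b} → U a ≡ true → U b ≡ true → a ≢ b → E G a b ⇔ Alternate G a b w
    occurs    : ∀ {a} → U a ≡ true → occ G a w ≡ k

module _ {G : Graph} where
  open Words (_≟_ G)

  KRepresentsOn-filterᵇ : ∀ (U : V G → Bool) {k w} → Represents G w → (∀ v → occ G v w ≡ k)
                        → KRepresentsOn G U k (filterᵇ U w)
  KRepresentsOn-filterᵇ U {k} {w} (_ , rep) counts = record
    { over      = filterᵇ-true U w
    ; alternate = λ {a} {b} Ua Ub a≢b →
        mk⇔ (subst Alternating (sym (subword-filterᵇ U w Ua Ub)) ∘ proj₁ (rep a b a≢b))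
            (proj₂ (rep a b a≢b) ∘ subst Alternating (subword-filterᵇ U w Ua Ub))
    ; occurs    = λ {a} Ua → trans (count-filterᵇ U w Ua) (counts a)
    }

  KRepresentsOn-rotate : ∀ {U k} p q → KRepresentsOn G U k (p ++ q) → KRepresentsOn G U k (q ++ p)
  KRepresentsOn-rotate {U} {k} p q R = record
    { over      = Allₚ.++⁺ (Allₚ.++⁻ʳ p over) (Allₚ.++⁻ˡ p over)
    ; alternate = λ Ua Ub a≢b →
        mk⇔ (alternating-subword-rotate p q a≢b (balanced Ua Ub) ∘ Equivalence.to (alternate Ua Ub a≢b))
            (Equivalence.from (alternate Ua Ub a≢b) ∘ alternating-subword-rotate q p a≢b (balanced′ Ua Ub))
    ; occurs    = occurs′
    }
    where
    open KRepresentsOn R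
    occurs′ : ∀ {a} → U a ≡ true → count a (q ++ p) ≡ k
    occurs′ Ua = trans (count-++-comm _ q p) (occurs Ua)
    balanced : ∀ {a b} → U a ≡ true → U b ≡ true → count a (p ++ q) ≡ count b (p ++ q)
    balanced Ua Ub = trans (occurs Ua) (sym (occurs Ub))
    balanced′ : ∀ {a b} → U a ≡ true → U b ≡ true → count a (q ++ p) ≡ count b (q ++ p)
    balanced′ Ua Ub = trans (occurs′ Ua) (sym (occurs′ Ub))

module Embedding {H G : Graph} (ψ : V H → V G) (ψ-injective : ∀ {c d} → ψ c ≡ ψ d → c ≡ d)
                 (ψ-edge : ∀ {c d} → E H c d ⇔ E G (ψ c) (ψ d))
                 (U : V G → Bool) (U-ψ : ∀ c → U (ψ c) ≡ true)
                 (ψ-onto : ∀ {z} → U z ≡ true → Σ (V H) λ c → ψ c ≡ z) where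
  open WordMap (_≟_ H) (_≟_ G) ψ ψ-injective
  open Words (_≟_ H) using (count>0⇒∈)

  KRepresentable⇒KRepresentsOn : ∀ {k} → KRepresentable H k → Σ (List (V G)) (KRepresentsOn G U k)
  KRepresentable⇒KRepresentsOn {k} (w , (_ , rep) , counts) = map ψ w , record
    { over      = Allₚ.map⁺ (All.universal U-ψ w)
    ; alternate = alternate
    ; occurs    = occurs
    }
    where
    alternate : ∀ {a b} → U a ≡ true → U b ≡ true → a ≢ b → E G a b ⇔ Alternate G a b (map ψ w)
    alternate Ua Ub a≢b with ψ-onto Ua | ψ-onto Ub
    ... | c , refl | d , refl =
      ⇔.trans (⇔.sym ψ-edge)
              (⇔.trans (mk⇔ (proj₁ (rep c d c≢d)) (proj₂ (rep c d c≢d))) (alternating-subword-map w c≢d))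
      where
      c≢d : c ≢ d
      c≢d = a≢b ∘ cong ψ
    occurs : ∀ {a} → U a ≡ true → occ G a (map ψ w) ≡ k
    occurs Ua with ψ-onto Ua
    ... | c , refl = trans (count-map c w) (counts c)

  private
    lift : ∀ w → All (λ z → U z ≡ true) w → Σ (List (V H)) λ w₁ → map ψ w₁ ≡ w
    lift []      []          = [] , refl
    lift (z ∷ w) (Uz ∷ w-U) with ψ-onto Uz | lift w w-U
    ... | c , refl | w₁ , refl = c ∷ w₁ , refl

  KRepresentsOn⇒KRepresentable : ∀ {k w} → 0 < k → KRepresentsOn G U k w → KRepresentable H k
  KRepresentsOn⇒KRepresentable {k} {w} k>0 R with lift w (KRepresentsOn.over R)
  ... | w₁ , refl = w₁ , (all , rep) , counts
    where
    open KRepresentsOn R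
    counts : ∀ c → occ H c w₁ ≡ k
    counts c = trans (sym (count-map c w₁)) (occurs (U-ψ c))
    all : ∀ c → c ∈ w₁
    all c = count>0⇒∈ w₁ (subst (0 <_) (sym (counts c)) k>0)
    rep : ∀ c d → c ≢ d → (E H c d → Alternate H c d w₁) × (Alternate H c d w₁ → E H c d)
    rep c d c≢d = Equivalence.to e , Equivalence.from e
      where
      e : E H c d ⇔ Alternate H c d w₁
      e = ⇔.trans ψ-edge
            (⇔.trans (alternate (U-ψ c) (U-ψ d) (c≢d ∘ ψ-injective)) (⇔.sym (alternating-subword-map w₁ c≢d)))

module _ (G : Graph) (P : V G → Bool) where

  record Crossing : Set where
    field
      {x₀ y₀} : V G
      Px₀     : P x₀ ≡ true
      Py₀     : P y₀ ≡ false
      x₀y₀    : E G x₀ y₀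

  path-crossing : ∀ {x y} → Path G x y → P x ≡ true → P y ≡ false → Crossing
  path-crossing here Px Py = ⊥-elim (Boolₚ.not-¬ Px Py)
  path-crossing (step {w = w} e p) Px Py with P w in Pw
  ... | true  = path-crossing p Pw Py
  ... | false = record { Px₀ = Px ; Py₀ = Pw ; x₀y₀ = e }

  private
    H : Graph
    H = component G P

    Covers : V H → V G → Set
    Covers (just (x , _)) v = x ≡ v
    Covers nothing        v = T (not (P v))

    covers-unique : ∀ c d {v} → Covers c v → Covers d v → c ≡ d
    covers-unique nothing        nothing        _    _   = refl
    covers-unique (just (x , p)) (just (y , q)) refl refl = cong (λ r → just (x , r)) (Boolₚ.T-irrelevant p q)
    covers-unique nothing        (just (y , q)) ¬Py refl = ⊥-elim (subst T (Equivalence.to Boolₚ.T-not-≡ ¬Py) q)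
    covers-unique (just (x , p)) nothing        refl ¬Px = ⊥-elim (subst T (Equivalence.to Boolₚ.T-not-≡ ¬Px) p)

    cover : ∀ v → Σ (V H) λ c → Covers c v
    cover v with P v in Pv
    ... | true  = just (v , Equivalence.from Boolₚ.T-≡ Pv) , refl
    ... | false = nothing , Equivalence.from Boolₚ.T-not-≡ Pv

    covers-edge : ∀ c d {u v} → Covers c u → Covers d v → E G u v → E H c d ⊎ c ≡ d
    covers-edge (just _)       (just _)       refl refl e = inj₁ e
    covers-edge (just (x , p)) nothing        refl ¬Pv  e = inj₁ (T-not-not p , _ , ¬Pv , E-sym G e)
    covers-edge nothing        (just (y , q)) ¬Pu  refl e = inj₁ (T-not-not q , _ , ¬Pu , e)
    covers-edge nothing        nothing        _    _    _ = inj₂ refl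

    lift-path : ∀ {u v} → Path G u v → ∀ c d → Covers c u → Covers d v → Path H c d
    lift-path here c d cu dv rewrite covers-unique c d cu dv = here
    lift-path (step {w = w} e p) c d cu dv with cover w
    ... | c′ , c′w with covers-edge c c′ cu c′w e
    ...   | inj₁ e′   = step e′ (lift-path p c′ d c′w dv)
    ...   | inj₂ refl = lift-path p c d c′w dv

  component-connected : Connected G → ∀ {z} → P z ≡ false → Connected (component G P)
  component-connected connected {z} Pz c d = lift-path (connected (proj₁ (witness c)) (proj₁ (witness d))) c d
                                                       (proj₂ (witness c)) (proj₂ (witness d))
    where
    witness : ∀ c → Σ (V G) (Covers c)
    witness (just (x , _)) = x , refl
    witness nothing        = z , Equivalence.from Boolₚ.T-not-≡ Pz

module ComponentEmbedding (G : Graph) (P : V G → Bool) {m : V G} (m-in-N : InNbhd G P m)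
                          (m-adjacent : ∀ {y} → InNbhd G (λ z → not (P z)) y → E G y m) where
  open Words (_≟_ G)

  ψ : V (component G P) → V G
  ψ nothing        = m
  ψ (just (x , _)) = x

  U : V G → Bool
  U z = P z ∨ z ≡ᵇ m

  U-ψ : ∀ c → U (ψ c) ≡ true
  U-ψ nothing        rewrite ≡ᵇ-refl m = Boolₚ.∨-zeroʳ (P m)
  U-ψ (just (x , p)) rewrite Equivalence.to Boolₚ.T-≡ p = refl

  private
    Pm : P m ≡ false
    Pm = Equivalence.to Boolₚ.T-not-≡ (proj₁ m-in-N)

    ψ-injective : ∀ {c d} → ψ c ≡ ψ d → c ≡ d
    ψ-injective {nothing}      {nothing}      _    = refl
    ψ-injective {nothing}      {just (y , q)} refl = ⊥-elim (subst T Pm q)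
    ψ-injective {just (x , p)} {nothing}      refl = ⊥-elim (subst T Pm p)
    ψ-injective {just (x , p)} {just (y , q)} refl = cong (λ r → just (x , r)) (Boolₚ.T-irrelevant p q)

    ψ-edge : ∀ {c d} → E (component G P) c d ⇔ E G (ψ c) (ψ d)
    ψ-edge {nothing}      {nothing}      = mk⇔ (λ ()) (E-irr G)
    ψ-edge {nothing}      {just (y , q)} = mk⇔ (E-sym G ∘ m-adjacent) (λ e → T-not-not q , m , proj₁ m-in-N , e)
    ψ-edge {just (x , p)} {nothing}      = mk⇔ m-adjacent (λ e → T-not-not p , m , proj₁ m-in-N , E-sym G e)
    ψ-edge {just _}       {just _}       = ⇔.refl

    ψ-onto : ∀ {z} → U z ≡ true → Σ (V (component G P)) λ c → ψ c ≡ z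
    ψ-onto {z} Uz with P z in Pz
    ... | true  = just (z , Equivalence.from Boolₚ.T-≡ Pz) , refl
    ... | false = nothing , sym (≡ᵇ-true⇒≡ Uz)

  open Embedding {component G P} {G} ψ ψ-injective (λ {c} {d} → ψ-edge {c} {d}) U U-ψ ψ-onto public

-- Gluing along a split

module SplitGlue (G : Graph) (S : V G → Bool) {x₀ y₀ : V G} (Sx₀ : S x₀ ≡ true) (Sy₀ : S y₀ ≡ false)
                 (edge⇔ : ∀ {a b} → S a ≡ true → S b ≡ false → E G a b ⇔ (E G x₀ b × E G a y₀)) where
  open Words (_≟_ G)
  open Glue x₀ y₀

  U₁ U₂ : V G → Bool
  U₁ z = S z ∨ z ≡ᵇ y₀
  U₂ z = not (S z) ∨ z ≡ᵇ x₀

  private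
    across-≢ : ∀ {a b} → S a ≡ true → S b ≡ false → a ≢ b
    across-≢ Sa Sb refl = Boolₚ.not-¬ Sa Sb

    U₁-S : ∀ {z} → S z ≡ true → U₁ z ≡ true
    U₁-S Sz rewrite Sz = refl

    U₂-S : ∀ {z} → S z ≡ false → U₂ z ≡ true
    U₂-S Sz rewrite Sz = refl

    U₁y₀ : U₁ y₀ ≡ true
    U₁y₀ rewrite ≡ᵇ-refl y₀ = Boolₚ.∨-zeroʳ _

    U₂x₀ : U₂ x₀ ≡ true
    U₂x₀ rewrite ≡ᵇ-refl x₀ = Boolₚ.∨-zeroʳ _

    U₁-letter : ∀ {z} → U₁ z ≡ true → z ≡ y₀ ⊎ S z ≡ true
    U₁-letter {z} U₁z with S z
    ... | true  = inj₂ refl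
    ... | false = inj₁ (≡ᵇ-true⇒≡ U₁z)

    U₂-letter : ∀ {z} → U₂ z ≡ true × z ≢ x₀ → S z ≡ false
    U₂-letter {z} (U₂z , z≢x₀) rewrite ≢⇒≡ᵇ-false z≢x₀ | Boolₚ.∨-identityʳ (not (S z)) =
      trans (sym (Boolₚ.not-involutive (S z))) (cong not U₂z)

  module _ {k w₁ ss} (R₁ : KRepresentsOn G U₁ k w₁) (R₂ : KRepresentsOn G U₂ k (separated ss))
           (ss≢x₀ : All (All (_≢ x₀)) ss) where
    private
      module R₁ = KRepresentsOn R₁
      module R₂ = KRepresentsOn R₂

      glued : List (V G)
      glued = glue w₁ ss

      segments-outside : All (All (λ z → S z ≡ false)) ss
      segments-outside = All.zipWith (All.zipWith U₂-letter) (All-separated⁻ ss R₂.over , ss≢x₀)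

      length-ss : length ss ≡ k
      length-ss = trans (sym (count-separated ss ss≢x₀)) (R₂.occurs U₂x₀)

      count-y₀ : count y₀ w₁ ≡ length ss
      count-y₀ = trans (R₁.occurs U₁y₀) (sym length-ss)

      filterᵇ-glued₁ : ∀ p → (∀ {z} → S z ≡ false → p z ≡ false)
                     → filterᵇ p glued ≡ filterᵇ p w₁
      filterᵇ-glued₁ p p-off = filterᵇ-glue-left p w₁ ss (p-off Sy₀) (All.map (All.map p-off) segments-outside)

      filterᵇ-glued₂ : ∀ p → (∀ {z} → S z ≡ true → p z ≡ false)
                     → filterᵇ p glued ≡ filterᵇ p (separated ss)
      filterᵇ-glued₂ p p-off =
        trans (filterᵇ-glue-right p w₁ ss (All.map (Sum.map₂ p-off ∘ U₁-letter) R₁.over) count-y₀)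
              (sym (filterᵇ-separated-false p ss (p-off Sx₀)))

      occurs : ∀ v → count v glued ≡ k
      occurs v with S v in Sv
      ... | true  = trans (cong length (filterᵇ-glued₁ _ λ Sz → ≢⇒≡ᵇ-false (across-≢ Sv Sz ∘ sym)))
                          (R₁.occurs (U₁-S Sv))
      ... | false = trans (cong length (filterᵇ-glued₂ _ λ Sz → ≢⇒≡ᵇ-false (across-≢ Sz Sv)))
                          (R₂.occurs (U₂-S Sv))

      alternate-within₁ : ∀ {a b} → S a ≡ true → S b ≡ true → a ≢ b → E G a b ⇔ Alternate G a b glued
      alternate-within₁ {a} {b} Sa Sb a≢b =
        ⇔.trans (R₁.alternate (U₁-S Sa) (U₁-S Sb) a≢b) (Alternating-≡ (sym (filterᵇ-glued₁ _ off)))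
        where
        off : ∀ {z} → S z ≡ false → (z ≡ᵇ a ∨ z ≡ᵇ b) ≡ false
        off Sz = cong₂ _∨_ (≢⇒≡ᵇ-false (across-≢ Sa Sz ∘ sym)) (≢⇒≡ᵇ-false (across-≢ Sb Sz ∘ sym))

      alternate-within₂ : ∀ {a b} → S a ≡ false → S b ≡ false → a ≢ b → E G a b ⇔ Alternate G a b glued
      alternate-within₂ {a} {b} Sa Sb a≢b =
        ⇔.trans (R₂.alternate (U₂-S Sa) (U₂-S Sb) a≢b) (Alternating-≡ (sym (filterᵇ-glued₂ _ off)))
        where
        off : ∀ {z} → S z ≡ true → (z ≡ᵇ a ∨ z ≡ᵇ b) ≡ false
        off Sz = cong₂ _∨_ (≢⇒≡ᵇ-false (across-≢ Sz Sa)) (≢⇒≡ᵇ-false (across-≢ Sz Sb))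

      b-parts : V G → List (List (V G))
      b-parts b = map (filterᵇ (_≡ᵇ b)) ss

      subword-glued-across : ∀ {a b} → S a ≡ true → S b ≡ false
                           → subword a b glued ≡ glue (subword a y₀ w₁) (b-parts b)
      subword-glued-across {a} {b} Sa Sb = trans (filterᵇ-glue _ w₁ ss)
        (cong₂ glue (filterᵇ-cong-local (All.map on-w₁ R₁.over))
                    (Listₚ.map-cong-local (All.map (filterᵇ-cong-local ∘ All.map on-segment) segments-outside)))
        where
        on-w₁ : ∀ {z} → U₁ z ≡ true
              → ((z ≡ᵇ a ∨ z ≡ᵇ b) ∨ z ≡ᵇ y₀) ≡ (z ≡ᵇ a ∨ z ≡ᵇ y₀)
        on-w₁ {z} U₁z with U₁-letter U₁z
        ... | inj₁ refl rewrite ≡ᵇ-refl y₀ = trans (Boolₚ.∨-zeroʳ _) (sym (Boolₚ.∨-zeroʳ _))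
        ... | inj₂ Sz rewrite ≢⇒≡ᵇ-false (across-≢ Sz Sb) | Boolₚ.∨-identityʳ (z ≡ᵇ a) = refl
        on-segment : ∀ {z} → S z ≡ false → (z ≡ᵇ a ∨ z ≡ᵇ b) ≡ (z ≡ᵇ b)
        on-segment {z} Sz = cong (_∨ z ≡ᵇ b) (≢⇒≡ᵇ-false (across-≢ Sa Sz ∘ sym))

      subword-separated-across : ∀ {b} → S b ≡ false → subword x₀ b (separated ss) ≡ separated (b-parts b)
      subword-separated-across {b} Sb = trans (filterᵇ-separated _ ss (cong (_∨ x₀ ≡ᵇ b) (≡ᵇ-refl x₀)))
        (cong separated (Listₚ.map-cong-local (All.map (filterᵇ-cong-local ∘ All.map on-segment) ss≢x₀)))
        where
        on-segment : ∀ {z} → z ≢ x₀ → (z ≡ᵇ x₀ ∨ z ≡ᵇ b) ≡ (z ≡ᵇ b)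
        on-segment {z} z≢x₀ = cong (_∨ z ≡ᵇ b) (≢⇒≡ᵇ-false z≢x₀)

      length-b-parts : ∀ {b} → S b ≡ false → length (concat (b-parts b)) ≡ length (b-parts b)
      length-b-parts {b} Sb = begin
        length (concat (b-parts b))    ≡⟨ cong length (filterᵇ-concat _ ss) ⟨
        count b (concat ss)
          ≡⟨ cong length (filterᵇ-separated-false _ ss (≢⇒≡ᵇ-false (across-≢ Sx₀ Sb))) ⟨
        count b (separated ss)         ≡⟨ R₂.occurs (U₂-S Sb) ⟩
        k                              ≡⟨ length-ss ⟨
        length ss                      ≡⟨ Listₚ.length-map _ ss ⟨
        length (b-parts b)             ∎
        where open ≡-Reasoning

      alternate-across : ∀ {a b} → S a ≡ true → S b ≡ false → E G a b ⇔ Alternate G a b glued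
      alternate-across {a} {b} Sa Sb =
        ⇔.trans (edge⇔ Sa Sb)
          (⇔.trans (x₀b ×-⇔ ay₀) (⇔.sym (⇔.trans (Alternating-≡ (subword-glued-across Sa Sb)) glue⇔)))
        where
        x₀b : E G x₀ b ⇔ Alternating (separated (b-parts b))
        x₀b = ⇔.trans (R₂.alternate U₂x₀ (U₂-S Sb) (across-≢ Sx₀ Sb))
                      (Alternating-≡ (subword-separated-across Sb))
        ay₀ : E G a y₀ ⇔ Alternating (subword a y₀ w₁)
        ay₀ = R₁.alternate (U₁-S Sa) U₁y₀ (across-≢ Sa Sy₀)
        glue⇔ : Alternating (glue (subword a y₀ w₁) (b-parts b))
              ⇔ (Alternating (separated (b-parts b)) × Alternating (subword a y₀ w₁))
        glue⇔ = alternating-glue⇔ (subword a y₀ w₁) (b-parts b)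
          (across-≢ Sa Sy₀) (across-≢ Sa Sb) (across-≢ Sx₀ Sb)
          (subword-Over a y₀ w₁)
          (Allₚ.map⁺ (All.universal (λ s → All.map ≡ᵇ-true⇒≡ (filterᵇ-true _ s)) ss))
          (trans (count-subwordʳ a y₀ w₁) (trans count-y₀ (sym (Listₚ.length-map _ ss))))
          (length-b-parts Sb)

      alternate : ∀ a b → a ≢ b → E G a b ⇔ Alternate G a b glued
      alternate a b a≢b with S a in Sa | S b in Sb
      ... | true  | true  = alternate-within₁ Sa Sb a≢b
      ... | false | false = alternate-within₂ Sa Sb a≢b
      ... | true  | false = alternate-across Sa Sb
      ... | false | true  =
        ⇔.trans (mk⇔ (E-sym G) (E-sym G))
                (⇔.trans (alternate-across Sb Sa) (Alternating-≡ (subword-comm b a glued)))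

    glue-KRepresentable : 0 < k → KRepresentable G k
    glue-KRepresentable k>0 =
      glued ,
      ((λ v → count>0⇒∈ glued (subst (0 <_) (sym (occurs v)) k>0)) ,
       λ a b a≢b → Equivalence.to (alternate a b a≢b) , Equivalence.from (alternate a b a≢b)) ,
      occurs

KRepresentable⇒0< : ∀ {H k} → V H → KRepresentable H k → 0 < k
KRepresentable⇒0< {H} v (w , (w-all , _) , counts) = subst (0 <_) (counts v) (Words.∈⇒count>0 (_≟_ H) (w-all v))

module Split (G : Graph) (S : V G → Bool) (split : IsSplit G S) (connected : Connected G) where
  private
    G₁ = component G S
    G₂ = component G (λ x → not (S x))

    crossing : Crossing G S
    crossing =
      let (x₁ , _ , _ , Sx₁ , _) , (z₁ , _ , _ , ¬Sz₁ , _) , _ = split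
      in path-crossing G S (connected x₁ z₁)
                       (Equivalence.to Boolₚ.T-≡ Sx₁) (Equivalence.to Boolₚ.T-not-≡ ¬Sz₁)

    open Crossing crossing renaming (Px₀ to Sx₀; Py₀ to Sy₀)

    adjacent : ∀ x y → InNbhd G S x → InNbhd G (λ z → not (S z)) y → E G x y
    adjacent = proj₂ (proj₂ split)

    in-S : ∀ {x} → S x ≡ true → T (S x)
    in-S = Equivalence.from Boolₚ.T-≡

    out-S : ∀ {x} → S x ≡ false → T (not (S x))
    out-S = Equivalence.from Boolₚ.T-not-≡

    in-S′ : ∀ {x} → S x ≡ true → T (not (not (S x)))
    in-S′ = T-not-not ∘ in-S

    y₀-in-N : InNbhd G S y₀
    y₀-in-N = out-S Sy₀ , x₀ , in-S Sx₀ , x₀y₀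

    x₀-in-N : InNbhd G (λ z → not (S z)) x₀
    x₀-in-N = in-S′ Sx₀ , y₀ , out-S Sy₀ , E-sym G x₀y₀

    not-not-InNbhd : ∀ {y} → InNbhd G (λ z → not (not (S z))) y → InNbhd G S y
    not-not-InNbhd {y} (¬¬¬Sy , z , ¬¬Sz , e) =
      subst T (cong not (Boolₚ.not-involutive (S y))) ¬¬¬Sy , z , subst T (Boolₚ.not-involutive (S z)) ¬¬Sz , e

    edge⇔ : ∀ {a b} → S a ≡ true → S b ≡ false → E G a b ⇔ (E G x₀ b × E G a y₀)
    edge⇔ {a} {b} Sa Sb = mk⇔
      (λ e → E-sym G (adjacent b x₀ (out-S Sb , a , in-S Sa , e) x₀-in-N) ,
             E-sym G (adjacent y₀ a y₀-in-N (in-S′ Sa , b , out-S Sb , E-sym G e)))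
      (λ (x₀b , ay₀) → E-sym G (adjacent b a (out-S Sb , x₀ , in-S Sx₀ , x₀b)
                                              (in-S′ Sa , y₀ , out-S Sy₀ , E-sym G ay₀)))

    module C₁ = ComponentEmbedding G S y₀-in-N (λ y-in-N → E-sym G (adjacent y₀ _ y₀-in-N y-in-N))
    module C₂ = ComponentEmbedding G (λ z → not (S z)) x₀-in-N
                                   (λ y-in-N → adjacent _ x₀ (not-not-InNbhd y-in-N) x₀-in-N)
    open SplitGlue G S Sx₀ Sy₀ edge⇔
    open Words (_≟_ G)
    open Glue x₀ y₀

    separated-representation : ∀ {k w₂} → 0 < k → KRepresentsOn G U₂ k w₂
                             → Σ (List (List (V G))) λ ss →
                               KRepresentsOn G U₂ k (separated ss) × All (All (_≢ x₀)) ss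
    separated-representation {k} {w₂} k>0 R₂
      with p , q , ss , refl , qp≡ss , ss≢x₀ ←
             rotation-separated (count>0⇒∈ w₂ (subst (0 <_) (sym (KRepresentsOn.occurs R₂ (C₂.U-ψ nothing))) k>0))
      = ss , subst (KRepresentsOn G U₂ k) qp≡ss (KRepresentsOn-rotate p q R₂) , ss≢x₀

    glue-components : ∀ {k} → KRepresentable G₁ k → KRepresentable G₂ k → KRepresentable G k
    glue-components {k} r₁ r₂ =
      let _ , R₁ = C₁.KRepresentable⇒KRepresentsOn r₁
          _ , R₂ = C₂.KRepresentable⇒KRepresentsOn r₂
          _ , R₂′ , ss≢x₀ = separated-representation k>0 R₂
      in glue-KRepresentable R₁ R₂′ ss≢x₀ k>0
      where
      k>0 : 0 < k
      k>0 = KRepresentable⇒0< {G₁} nothing r₁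

  KRepresentable⇔components : ∀ k → KRepresentable G k ⇔ (KRepresentable G₁ k × KRepresentable G₂ k)
  KRepresentable⇔components k = mk⇔
    (λ r@(w , rep , counts) →
      C₁.KRepresentsOn⇒KRepresentable (KRepresentable⇒0< {G} x₀ r) (KRepresentsOn-filterᵇ C₁.U rep counts) ,
      C₂.KRepresentsOn⇒KRepresentable (KRepresentable⇒0< {G} x₀ r) (KRepresentsOn-filterᵇ C₂.U rep counts))
    (λ (r₁ , r₂) → glue-components r₁ r₂)

  components-connected : Connected G₁ × Connected G₂
  components-connected =
    component-connected G S connected Sy₀ ,
    component-connected G (λ z → not (S z)) connected (cong not Sx₀)

-- Split decompositions

KRepresentable⇔decomposition : ∀ {G Hs} → SplitDecomposition G Hs → Connected G
                             → ∀ k → KRepresentable G k ⇔ All (λ H → KRepresentable H k) Hs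
KRepresentable⇔decomposition trivial _ k = mk⇔ (_∷ []) All.head
KRepresentable⇔decomposition {G} (split {L₁ = L₁} S is-split d₁ d₂) connected k =
  ⇔.trans (KRepresentable⇔components k)
    (⇔.trans (KRepresentable⇔decomposition d₁ connected₁ k ×-⇔
              KRepresentable⇔decomposition d₂ connected₂ k)
             (mk⇔ (λ (rs₁ , rs₂) → Allₚ.++⁺ rs₁ rs₂) (Allₚ.++⁻ L₁)))
  where
  open Split G S is-split connected
  connected₁ = proj₁ components-connected
  connected₂ = proj₂ components-connected

module _ where
  open Uniform

  KRepresentable-pointwise : ∀ {Hs} → All WordRepresentable Hs → Σ (List ℕ) (Pointwise KRepresentable Hs)
  KRepresentable-pointwise []           = [] , []
  KRepresentable-pointwise {H ∷ _} (wr ∷ wrs) =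
    let k , r = WordRepresentable⇒KRepresentable H wr
        ks , rs = KRepresentable-pointwise wrs
    in k ∷ ks , r ∷ rs

  KRepresentable-maximum : ∀ {Hs ks} → Pointwise KRepresentable Hs ks
                         → All (λ H → KRepresentable H (foldr _⊔_ 0 ks)) Hs
  KRepresentable-maximum []                    = []
  KRepresentable-maximum {H ∷ _} {k ∷ ks} (r ∷ rs) =
    KRepresentable-mono H (ℕₚ.m≤m⊔n k _) r ∷
    All.map (λ {H′} → KRepresentable-mono H′ (ℕₚ.m≤n⊔m k _)) (KRepresentable-maximum rs)

  RepNumber-maximum-≤ : ∀ {Hs ks j} → Pointwise RepNumber Hs ks → All (λ H → KRepresentable H j) Hs
            → foldr _⊔_ 0 ks ≤ j
  RepNumber-maximum-≤ []                []       = z≤n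
  RepNumber-maximum-≤ {j = j} ((_ , least) ∷ ns) (r ∷ rs) = ℕₚ.⊔-lub (least j r) (RepNumber-maximum-≤ ns rs)

theorem2 : (G : Graph) → Finite G → Connected G
         → (Hs : List Graph) → SplitDecomposition G Hs
         → (WordRepresentable G ⇔ All WordRepresentable Hs)
           × (∀ (ks : List ℕ) → Pointwise RepNumber Hs ks → RepNumber G (foldr _⊔_ 0 ks))
theorem2 G _ connected Hs d = mk⇔ to from , representation-number
  where
  K⇔ : ∀ k → KRepresentable G k ⇔ All (λ H → KRepresentable H k) Hs
  K⇔ = KRepresentable⇔decomposition d connected

  forget : ∀ {H k} → KRepresentable H k → WordRepresentable H
  forget (w , rep , _) = w , rep

  to : WordRepresentable G → All WordRepresentable Hs
  to wr = let k , r = Uniform.WordRepresentable⇒KRepresentable G wr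
          in All.map (λ {H} → forget {H}) (Equivalence.to (K⇔ k) r)

  from : All WordRepresentable Hs → WordRepresentable G
  from wrs = let ks , rs = KRepresentable-pointwise wrs
            in forget {G} (Equivalence.from (K⇔ (foldr _⊔_ 0 ks)) (KRepresentable-maximum rs))

  representation-number : ∀ ks → Pointwise RepNumber Hs ks → RepNumber G (foldr _⊔_ 0 ks)
  representation-number ks ns =
    Equivalence.from (K⇔ _) (KRepresentable-maximum (Pointwiseₚ.map proj₁ ns)) ,
    λ j r → RepNumber-maximum-≤ ns (Equivalence.to (K⇔ j) r)
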